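{- Let $\mathbb{M}\in\{\mathsf K,\mathsf D,\mathsf T,\mathsf{K4},\mathsf{S4}\}$ and let $\beta$ be a position. If $\Gamma\vdash\Delta$ is provable in $2_{\mathbb M}$, then so is $\Gamma[\langle\,\rangle/\beta]\vdash\Delta[\langle\,\rangle/\beta]$, i.e. the sequent obtained by replacing each p-formula $A^{\gamma}$ of $\Gamma$ and $\Delta$ by $A^{\beta\circ\gamma}$.
   Context: Modal formulas over proposition symbols with $\neg,\wedge,\vee,\to,\Box,\Diamond$. Fix a countably infinite set of tokens; a position is a finite (possibly empty) sequence of tokens, $\langle\,\rangle$ the empty one, $\circ$ concatenation, $\alpha\circ x=\alpha\circ\langle x\rangle$, $\beta\preceq\alpha$ means $\beta$ is a prefix of $\alpha$. A p-formula is $A^\alpha$; a 2-sequent is $\Gamma\vdash\Delta$ with $\Gamma,\Delta$ finite sequences of p-formulas; $I(\Gamma)=\{\beta:\exists A^\alpha\in\Gamma,\ \beta\preceq\alpha\}$. Calculus $2_{\mathsf{S4}}$: Axiom $A^\alpha\vdash A^\alpha$; Cut: from $\Gamma_1\vdash A^\alpha,\Delta_1$ and $\Gamma_2,A^\alpha\vdash\Delta_2$ infer $\Gamma_1,\Gamma_2\vdash\Delta_1,\Delta_2$; weakening, contraction, exchange; classical propositional sequent rules for $\neg,\wedge,\vee,\to$ with all active p-formulas at the same position; modal rules: ($\Box\vdash$) from $\Gamma,A^{\alpha\circ\beta}\vdash\Delta$ infer $\Gamma,(\Box A)^\alpha\vdash\Delta$; ($\vdash\Box$) from $\Gamma\vdash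 A^{\alpha\circ x},\Delta$ infer $\Gamma\vdash(\Box A)^\alpha,\Delta$; ($\Diamond\vdash$) from $\Gamma,A^{\alpha\circ x}\vdash\Delta$ infer $\Gamma,(\Diamond A)^\alpha\vdash\Delta$; ($\vdash\Diamond$) from $\Gamma\vdash A^{\alpha\circ\beta},\Delta$ infer $\Gamma\vdash(\Diamond A)^\alpha,\Delta$; $\beta$ a position, $x$ a token, and in $\vdash\Box,\Diamond\vdash$, $\alpha\circ x\notin I(\Gamma,\Delta)$. $2_{\mathsf T},2_{\mathsf D},2_{\mathsf{K4}},2_{\mathsf K}$ add constraints on $\Box\vdash,\vdash\Diamond$: $2_{\mathsf T}$: $\beta$ empty or a single token; $2_{\mathsf D}$: $\beta$ a single token; $2_{\mathsf{K4}}$: $\beta$ nonempty and $\Gamma$ or $\Delta$ contains some $B^{\alpha\circ\beta\circ\eta}$; $2_{\mathsf K}$: $\beta$ a single token and $\Gamma$ or $\Delta$ contains some $B^{\alpha\circ\beta\circ\eta}$. In $2_{\mathsf K},2_{\mathsf{K4}}$ Cut requires $\alpha\in I(\Gamma_1,\Delta_1)$ or $\alpha\in I(\Gamma_2,\Delta_2)$. -}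

module Defs where

open import Data.Nat using (ℕ)
open import Data.List using (List; []; _∷_; _++_; [_]; length; map)
open import Data.List.Membership.Propositional using (_∈_)
open import Data.Product using (Σ; ∃; _×_; _,_)
open import Data.Sum using (_⊎_)
open import Data.Unit using (⊤)
open import Relation.Nullary using (¬_)
open import Relation.Binary.PropositionalEquality using (_≡_; _≢_)

Prop : Set
Prop = ℕ

Token : Set
Token = ℕ

data Formula : Set where
  var  : Prop → Formula
  ¬'_  : Formula → Formula
  _∧'_ : Formula → Formula → Formula
  _∨'_ : Formula → Formula → Formula
  _→'_ : Formula → Formula → Formula
  □_   : Formula → Formula
  ◇_   : Formula → Formula

-- Positions: finite sequences of tokens; ∘ is list concatenation.
Position : Set
Position = List Token

_⪯_ : Position → Position → Set
β ⪯ α = ∃ λ γ → β ++ γ ≡ α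

record PFormula : Set where
  constructor _^_
  field
    formula  : Formula
    position : Position
open PFormula public

Seq : Set
Seq = List PFormula

_∈I_ : Position → Seq → Set
β ∈I Γ = ∃ λ P → P ∈ Γ × β ⪯ position P

data Logic : Set where
  𝐊 𝐃 𝐓 𝐊𝟒 𝐒𝟒 : Logic

Extends : Seq → Seq → Position → Position → Set
Extends Γ Δ α β = ∃ λ B → ∃ λ η → (B ^ (α ++ β ++ η)) ∈ (Γ ++ Δ)

ModalOK : Logic → Seq → Seq → Position → Position → Set
ModalOK 𝐒𝟒 Γ Δ α β = ⊤
ModalOK 𝐓  Γ Δ α β = β ≡ [] ⊎ ∃ λ (x : Token) → β ≡ [ x ]
ModalOK 𝐃  Γ Δ α β = ∃ λ (x : Token) → β ≡ [ x ]
ModalOK 𝐊𝟒 Γ Δ α β = β ≢ [] × Extends Γ Δ α β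
ModalOK 𝐊  Γ Δ α β = (∃ λ (x : Token) → β ≡ [ x ]) × Extends Γ Δ α β

CutOK : Logic → Seq → Seq → Seq → Seq → Position → Set
CutOK 𝐊  Γ₁ Δ₁ Γ₂ Δ₂ α = α ∈I (Γ₁ ++ Δ₁) ⊎ α ∈I (Γ₂ ++ Δ₂)
CutOK 𝐊𝟒 Γ₁ Δ₁ Γ₂ Δ₂ α = α ∈I (Γ₁ ++ Δ₁) ⊎ α ∈I (Γ₂ ++ Δ₂)
CutOK 𝐃  _ _ _ _ _ = ⊤
CutOK 𝐓  _ _ _ _ _ = ⊤
CutOK 𝐒𝟒 _ _ _ _ _ = ⊤

Fresh : Position → Token → Seq → Seq → Set
Fresh α x Γ Δ = ¬ ((α ++ [ x ]) ∈I (Γ ++ Δ))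

-- Provability Γ ⊢ Δ in 2_M.  Antecedent principal formulas are written
-- at the right end (Γ , A), succedent ones at the left end (A , Δ).
data _⊢[_]_ : Seq → Logic → Seq → Set where
  ax   : ∀ {M A α} → [ A ^ α ] ⊢[ M ] [ A ^ α ]
  cut  : ∀ {M Γ₁ Δ₁ Γ₂ Δ₂ A α} → CutOK M Γ₁ Δ₁ Γ₂ Δ₂ α →
         Γ₁ ⊢[ M ] ((A ^ α) ∷ Δ₁) → (Γ₂ ++ [ A ^ α ]) ⊢[ M ] Δ₂ →
         (Γ₁ ++ Γ₂) ⊢[ M ] (Δ₁ ++ Δ₂)
  wkL  : ∀ {M Γ Δ P} → Γ ⊢[ M ] Δ → (Γ ++ [ P ]) ⊢[ M ] Δ
  wkR  : ∀ {M Γ Δ P} → Γ ⊢[ M ] Δ → Γ ⊢[ M ] (P ∷ Δ)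
  ctrL : ∀ {M Γ Δ P} → (Γ ++ P ∷ P ∷ []) ⊢[ M ] Δ → (Γ ++ [ P ]) ⊢[ M ] Δ
  ctrR : ∀ {M Γ Δ P} → Γ ⊢[ M ] (P ∷ P ∷ Δ) → Γ ⊢[ M ] (P ∷ Δ)
  exL  : ∀ {M Γ₁ Γ₂ Δ P Q} → (Γ₁ ++ P ∷ Q ∷ Γ₂) ⊢[ M ] Δ → (Γ₁ ++ Q ∷ P ∷ Γ₂) ⊢[ M ] Δ
  exR  : ∀ {M Γ Δ₁ Δ₂ P Q} → Γ ⊢[ M ] (Δ₁ ++ P ∷ Q ∷ Δ₂) → Γ ⊢[ M ] (Δ₁ ++ Q ∷ P ∷ Δ₂)
  ¬L   : ∀ {M Γ Δ A α} → Γ ⊢[ M ] ((A ^ α) ∷ Δ) → (Γ ++ [ (¬' A) ^ α ]) ⊢[ M ] Δ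
  ¬R   : ∀ {M Γ Δ A α} → (Γ ++ [ A ^ α ]) ⊢[ M ] Δ → Γ ⊢[ M ] (((¬' A) ^ α) ∷ Δ)
  ∧L₁  : ∀ {M Γ Δ A B α} → (Γ ++ [ A ^ α ]) ⊢[ M ] Δ → (Γ ++ [ (A ∧' B) ^ α ]) ⊢[ M ] Δ
  ∧L₂  : ∀ {M Γ Δ A B α} → (Γ ++ [ B ^ α ]) ⊢[ M ] Δ → (Γ ++ [ (A ∧' B) ^ α ]) ⊢[ M ] Δ
  ∧R   : ∀ {M Γ Δ A B α} → Γ ⊢[ M ] ((A ^ α) ∷ Δ) → Γ ⊢[ M ] ((B ^ α) ∷ Δ) →
         Γ ⊢[ M ] (((A ∧' B) ^ α) ∷ Δ)
  ∨L   : ∀ {M Γ Δ A B α} → (Γ ++ [ A ^ α ]) ⊢[ M ] Δ → (Γ ++ [ B ^ α ]) ⊢[ M ] Δ →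
         (Γ ++ [ (A ∨' B) ^ α ]) ⊢[ M ] Δ
  ∨R₁  : ∀ {M Γ Δ A B α} → Γ ⊢[ M ] ((A ^ α) ∷ Δ) → Γ ⊢[ M ] (((A ∨' B) ^ α) ∷ Δ)
  ∨R₂  : ∀ {M Γ Δ A B α} → Γ ⊢[ M ] ((B ^ α) ∷ Δ) → Γ ⊢[ M ] (((A ∨' B) ^ α) ∷ Δ)
  →L   : ∀ {M Γ Δ A B α} → Γ ⊢[ M ] ((A ^ α) ∷ Δ) → (Γ ++ [ B ^ α ]) ⊢[ M ] Δ →
         (Γ ++ [ (A →' B) ^ α ]) ⊢[ M ] Δ
  →R   : ∀ {M Γ Δ A B α} → (Γ ++ [ A ^ α ]) ⊢[ M ] ((B ^ α) ∷ Δ) →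
         Γ ⊢[ M ] (((A →' B) ^ α) ∷ Δ)
  □L   : ∀ {M Γ Δ A α β} → ModalOK M Γ Δ α β →
         (Γ ++ [ A ^ (α ++ β) ]) ⊢[ M ] Δ → (Γ ++ [ (□ A) ^ α ]) ⊢[ M ] Δ
  □R   : ∀ {M Γ Δ A α x} → Fresh α x Γ Δ →
         Γ ⊢[ M ] ((A ^ (α ++ [ x ])) ∷ Δ) → Γ ⊢[ M ] (((□ A) ^ α) ∷ Δ)
  ◇L   : ∀ {M Γ Δ A α x} → Fresh α x Γ Δ →
         (Γ ++ [ A ^ (α ++ [ x ]) ]) ⊢[ M ] Δ → (Γ ++ [ (◇ A) ^ α ]) ⊢[ M ] Δ
  ◇R   : ∀ {M Γ Δ A α β} → ModalOK M Γ Δ α β →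
         Γ ⊢[ M ] ((A ^ (α ++ β)) ∷ Δ) → Γ ⊢[ M ] (((◇ A) ^ α) ∷ Δ)

shift : Position → PFormula → PFormula
shift β (A ^ γ) = A ^ (β ++ γ)

shiftSeq : Position → Seq → Seq
shiftSeq β = map (shift β)

module Submission where

-- Write s for shiftSeq b, i.e. A^γ ↦ A^{b∘γ}.  We show by induction on
-- derivations that s maps every rule instance of 2_M to a rule instance of
-- 2_M, so s Γ ⊢ s Δ is derivable whenever Γ ⊢ Δ is.  Two kinds of facts are
-- needed besides the bookkeeping s (Γ ++ Δ) = s Γ ++ s Δ:
--   * the position arithmetic b∘(α∘β) = (b∘α)∘β, so that a premise
--     A^{α∘β} of a modal rule shifts to the premise of the shifted rule;
--   * preservation of all side conditions.  Prefixes, membership and hence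
--     I(·) are preserved by s, which gives the Extends/ModalOK and CutOK
--     conditions of 2_K and 2_K4; conversely, a prefix of b∘γ of the form
--     b∘δ comes from a prefix δ of γ (left cancellation), so the
--     eigenposition condition α∘x ∉ I(Γ,Δ) is preserved as well.
-- The modal constraints on β itself are untouched, since only α is shifted.

open import Defs
open import Data.List using (_∷_; _++_; [_])
open import Data.List.Properties using (map-++; ++-assoc; ++-cancelˡ)
open import Data.List.Membership.Propositional using (_∈_)
open import Data.List.Membership.Propositional.Properties using (∈-map⁺; ∈-map⁻)
open import Data.Product using (_,_)
open import Data.Sum using (inj₁; inj₂)
open import Data.Unit using (tt)
open import Relation.Binary.PropositionalEquality
  using (_≡_; refl; sym; trans; cong; subst)

castL : ∀ {M Γ Γ' Δ} → Γ ≡ Γ' → Γ ⊢[ M ] Δ → Γ' ⊢[ M ] Δ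
castL refl d = d

castR : ∀ {M Γ Δ Δ'} → Δ ≡ Δ' → Γ ⊢[ M ] Δ → Γ ⊢[ M ] Δ'
castR refl d = d

module _ (b : Position) where

  private
    s : Seq → Seq
    s = shiftSeq b

  shift-++ : (Γ Δ : Seq) → s (Γ ++ Δ) ≡ s Γ ++ s Δ
  shift-++ Γ Δ = map-++ (shift b) Γ Δ

  -- Shifting a p-formula at position α∘β is the same as placing it at
  -- (b∘α)∘β: this is how the premise of a modal rule is matched.
  shift-assoc : (A : Formula) (α β : Position) →
                shift b (A ^ (α ++ β)) ≡ A ^ ((b ++ α) ++ β)
  shift-assoc A α β = cong (A ^_) (sym (++-assoc b α β))

  splitL : ∀ {M Δ} Γ₁ Γ₂ → s (Γ₁ ++ Γ₂) ⊢[ M ] Δ → (s Γ₁ ++ s Γ₂) ⊢[ M ] Δ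
  splitL Γ₁ Γ₂ = castL (shift-++ Γ₁ Γ₂)

  joinL : ∀ {M Δ} Γ₁ Γ₂ → (s Γ₁ ++ s Γ₂) ⊢[ M ] Δ → s (Γ₁ ++ Γ₂) ⊢[ M ] Δ
  joinL Γ₁ Γ₂ = castL (sym (shift-++ Γ₁ Γ₂))

  splitR : ∀ {M Γ} Δ₁ Δ₂ → Γ ⊢[ M ] s (Δ₁ ++ Δ₂) → Γ ⊢[ M ] (s Δ₁ ++ s Δ₂)
  splitR Δ₁ Δ₂ = castR (shift-++ Δ₁ Δ₂)

  joinR : ∀ {M Γ} Δ₁ Δ₂ → Γ ⊢[ M ] (s Δ₁ ++ s Δ₂) → Γ ⊢[ M ] s (Δ₁ ++ Δ₂)
  joinR Δ₁ Δ₂ = castR (sym (shift-++ Δ₁ Δ₂))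

  reassocL : ∀ {M Γ Δ A α β} → (Γ ++ [ A ^ (b ++ (α ++ β)) ]) ⊢[ M ] Δ →
             (Γ ++ [ A ^ ((b ++ α) ++ β) ]) ⊢[ M ] Δ
  reassocL {Γ = Γ} {A = A} {α} {β} = castL (cong (λ P → Γ ++ [ P ]) (shift-assoc A α β))

  reassocR : ∀ {M Γ Δ A α β} → Γ ⊢[ M ] ((A ^ (b ++ (α ++ β))) ∷ Δ) →
             Γ ⊢[ M ] ((A ^ ((b ++ α) ++ β)) ∷ Δ)
  reassocR {Δ = Δ} {A} {α} {β} = castR (cong (_∷ Δ) (shift-assoc A α β))

  ⪯-shift : ∀ {δ γ} → δ ⪯ γ → (b ++ δ) ⪯ (b ++ γ)
  ⪯-shift {δ} (η , eq) = η , trans (++-assoc b δ η) (cong (b ++_) eq)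

  ⪯-unshift : ∀ {δ γ} → (b ++ δ) ⪯ (b ++ γ) → δ ⪯ γ
  ⪯-unshift {δ} {γ} (η , eq) = η , ++-cancelˡ b (δ ++ η) γ (trans (sym (++-assoc b δ η)) eq)

  ∈-shift : ∀ {P} Γ Δ → P ∈ (Γ ++ Δ) → shift b P ∈ (s Γ ++ s Δ)
  ∈-shift Γ Δ m = subst (_ ∈_) (shift-++ Γ Δ) (∈-map⁺ (shift b) m)

  ∈I-shift : ∀ {α} Γ Δ → α ∈I (Γ ++ Δ) → (b ++ α) ∈I (s Γ ++ s Δ)
  ∈I-shift Γ Δ (P , m , p) = shift b P , ∈-shift Γ Δ m , ⪯-shift p

  ∈I-unshift : ∀ {α} Γ Δ → (b ++ α) ∈I (s Γ ++ s Δ) → α ∈I (Γ ++ Δ)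
  ∈I-unshift Γ Δ (P' , m , p)
    with ∈-map⁻ (shift b) (subst (P' ∈_) (sym (shift-++ Γ Δ)) m)
  ... | P , mP , refl = P , mP , ⪯-unshift p

  -- The eigenposition condition survives the shift: b∘α∘x ∈ I(s Γ, s Δ)
  -- would give α∘x ∈ I(Γ, Δ).
  fresh-shift : ∀ {α x} Γ Δ → Fresh α x Γ Δ → Fresh (b ++ α) x (s Γ) (s Δ)
  fresh-shift {α} {x} Γ Δ f i =
    f (∈I-unshift Γ Δ (subst (_∈I (s Γ ++ s Δ)) (++-assoc b α [ x ]) i))

  extends-shift : ∀ {α β} Γ Δ → Extends Γ Δ α β → Extends (s Γ) (s Δ) (b ++ α) β
  extends-shift {α} {β} Γ Δ (B , η , m) =
    B , η , subst (λ γ → (B ^ γ) ∈ (s Γ ++ s Δ)) (sym (++-assoc b α (β ++ η))) (∈-shift Γ Δ m)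

  modalOK-shift : ∀ M {α β} Γ Δ → ModalOK M Γ Δ α β → ModalOK M (s Γ) (s Δ) (b ++ α) β
  modalOK-shift 𝐊  Γ Δ (x , e) = x , extends-shift Γ Δ e
  modalOK-shift 𝐃  Γ Δ c       = c
  modalOK-shift 𝐓  Γ Δ c       = c
  modalOK-shift 𝐊𝟒 Γ Δ (x , e) = x , extends-shift Γ Δ e
  modalOK-shift 𝐒𝟒 Γ Δ c       = c

  cutOK-shift : ∀ M {α} Γ₁ Δ₁ Γ₂ Δ₂ → CutOK M Γ₁ Δ₁ Γ₂ Δ₂ α →
                CutOK M (s Γ₁) (s Δ₁) (s Γ₂) (s Δ₂) (b ++ α)
  cutOK-shift 𝐊  Γ₁ Δ₁ Γ₂ Δ₂ (inj₁ i) = inj₁ (∈I-shift Γ₁ Δ₁ i)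
  cutOK-shift 𝐊  Γ₁ Δ₁ Γ₂ Δ₂ (inj₂ i) = inj₂ (∈I-shift Γ₂ Δ₂ i)
  cutOK-shift 𝐃  Γ₁ Δ₁ Γ₂ Δ₂ c        = tt
  cutOK-shift 𝐓  Γ₁ Δ₁ Γ₂ Δ₂ c        = tt
  cutOK-shift 𝐊𝟒 Γ₁ Δ₁ Γ₂ Δ₂ (inj₁ i) = inj₁ (∈I-shift Γ₁ Δ₁ i)
  cutOK-shift 𝐊𝟒 Γ₁ Δ₁ Γ₂ Δ₂ (inj₂ i) = inj₂ (∈I-shift Γ₂ Δ₂ i)
  cutOK-shift 𝐒𝟒 Γ₁ Δ₁ Γ₂ Δ₂ c        = tt

  shift⊢ : ∀ {M Γ Δ} → Γ ⊢[ M ] Δ → s Γ ⊢[ M ] s Δ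
  shift⊢ ax = ax
  shift⊢ (cut {M} {Γ₁} {Δ₁} {Γ₂} {Δ₂} {A} {α} c d e) =
    joinL Γ₁ Γ₂ (joinR Δ₁ Δ₂
      (cut (cutOK-shift M Γ₁ Δ₁ Γ₂ Δ₂ c) (shift⊢ d) (splitL Γ₂ [ A ^ α ] (shift⊢ e))))
  shift⊢ (wkL {Γ = Γ} {P = P} d) = joinL Γ [ P ] (wkL (shift⊢ d))
  shift⊢ (wkR d) = wkR (shift⊢ d)
  shift⊢ (ctrL {Γ = Γ} {P = P} d) = joinL Γ [ P ] (ctrL (splitL Γ (P ∷ [ P ]) (shift⊢ d)))
  shift⊢ (ctrR d) = ctrR (shift⊢ d)
  shift⊢ (exL {Γ₁ = Γ₁} {Γ₂} {P = P} {Q} d) =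
    joinL Γ₁ (Q ∷ P ∷ Γ₂) (exL (splitL Γ₁ (P ∷ Q ∷ Γ₂) (shift⊢ d)))
  shift⊢ (exR {Δ₁ = Δ₁} {Δ₂} {P} {Q} d) =
    joinR Δ₁ (Q ∷ P ∷ Δ₂) (exR (splitR Δ₁ (P ∷ Q ∷ Δ₂) (shift⊢ d)))
  shift⊢ (¬L {Γ = Γ} {A = A} {α} d) = joinL Γ [ (¬' A) ^ α ] (¬L (shift⊢ d))
  shift⊢ (¬R {Γ = Γ} {A = A} {α} d) = ¬R (splitL Γ [ A ^ α ] (shift⊢ d))
  shift⊢ (∧L₁ {Γ = Γ} {A = A} {B} {α} d) =
    joinL Γ [ (A ∧' B) ^ α ] (∧L₁ (splitL Γ [ A ^ α ] (shift⊢ d)))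
  shift⊢ (∧L₂ {Γ = Γ} {A = A} {B} {α} d) =
    joinL Γ [ (A ∧' B) ^ α ] (∧L₂ (splitL Γ [ B ^ α ] (shift⊢ d)))
  shift⊢ (∧R d e) = ∧R (shift⊢ d) (shift⊢ e)
  shift⊢ (∨L {Γ = Γ} {A = A} {B} {α} d e) =
    joinL Γ [ (A ∨' B) ^ α ] (∨L (splitL Γ [ A ^ α ] (shift⊢ d)) (splitL Γ [ B ^ α ] (shift⊢ e)))
  shift⊢ (∨R₁ d) = ∨R₁ (shift⊢ d)
  shift⊢ (∨R₂ d) = ∨R₂ (shift⊢ d)
  shift⊢ (→L {Γ = Γ} {A = A} {B} {α} d e) =
    joinL Γ [ (A →' B) ^ α ] (→L (shift⊢ d) (splitL Γ [ B ^ α ] (shift⊢ e)))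
  shift⊢ (→R {Γ = Γ} {A = A} {α = α} d) = →R (splitL Γ [ A ^ α ] (shift⊢ d))
  shift⊢ (□L {M} {Γ} {Δ} {A} {α} {β} c d) =
    joinL Γ [ (□ A) ^ α ]
      (□L (modalOK-shift M Γ Δ c) (reassocL (splitL Γ [ A ^ (α ++ β) ] (shift⊢ d))))
  shift⊢ (□R {Γ = Γ} {Δ} f d) = □R (fresh-shift Γ Δ f) (reassocR (shift⊢ d))
  shift⊢ (◇L {M} {Γ} {Δ} {A} {α} {x} f d) =
    joinL Γ [ (◇ A) ^ α ]
      (◇L (fresh-shift Γ Δ f) (reassocL (splitL Γ [ A ^ (α ++ [ x ]) ] (shift⊢ d))))
  shift⊢ (◇R {M} {Γ} {Δ} c d) = ◇R (modalOK-shift M Γ Δ c) (reassocR (shift⊢ d))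

mainTheorem9 : (M : Logic) (β : Position) (Γ Δ : Seq) →
    Γ ⊢[ M ] Δ → shiftSeq β Γ ⊢[ M ] shiftSeq β Δ
mainTheorem9 M β Γ Δ d = shift⊢ β d
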